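{- Let $k$ be a non-negative integer. The linear rank-width of every graph in $\Delta_k$ is at least $k+1$.
   Context: Graphs are finite and simple. For $X\subseteq V(G)$, $\mathrm{cutrk}_G(X)$ is the rank over the binary field of the submatrix of the adjacency matrix of $G$ with rows $X$ and columns $V(G)\setminus X$. A linear layout of $G$ is an ordering $(v_1,\dots,v_n)$ of $V(G)$. Its width is $\max_i\mathrm{cutrk}_G(\{v_1,\dots,v_i\})$, or $0$ if $n\le 1$. The linear rank-width is the minimum width of a linear layout. A delta composition of $G_1,G_2,G_3$ is obtained from their disjoint union by choosing $v_i\in V(G_i)$ and adding the triangle $v_1v_2v_3$. $\Delta_0=\{K_2\}$, and for $i\ge1$, $\Delta_i$ is the set of delta compositions of three (not necessarily distinct) graphs in $\Delta_{i-1}$, up to isomorphism. -}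

module Defs where

open import Data.Bool using (Bool; true; false; _∧_; _∨_; not; _xor_; if_then_else_)
open import Data.Nat using (ℕ; zero; suc; _+_; _≤_; _<ᵇ_; _⊔_)
open import Data.Fin using (Fin; zero; suc; toℕ; splitAt; _↑ˡ_; _↑ʳ_; _≟_)
open import Data.Fin.Permutation using (Permutation′; _⟨$⟩ʳ_; _⟨$⟩ˡ_)
open import Data.List using (List; []; _∷_; map; concatMap; foldr; allFin; upTo)
open import Data.Sum using (inj₁; inj₂)
open import Data.Product using (Σ; ∃; ∃-syntax; _×_; _,_)
open import Relation.Nullary.Decidable using (⌊_⌋)
open import Relation.Binary.PropositionalEquality using (_≡_)

record RawGraph : Set where
  constructor mkRaw
  field
    size : ℕ
    adj  : Fin size → Fin size → Bool
open RawGraph public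

record Graph : Set where
  field
    raw    : RawGraph
    sym    : ∀ u v → adj raw u v ≡ adj raw v u
    irrefl : ∀ v → adj raw v v ≡ false
open Graph public

_≅_ : RawGraph → RawGraph → Set
G ≅ H = Σ (Data.Fin.Permutation.Permutation (size G) (size H)) λ π →
          ∀ u v → adj H (π ⟨$⟩ʳ u) (π ⟨$⟩ʳ v) ≡ adj G u v

K₂ : RawGraph
K₂ = mkRaw 2 λ u v → not ⌊ u ≟ v ⌋

_⊕_ : RawGraph → RawGraph → RawGraph
G ⊕ H = mkRaw (size G + size H) λ u v → go (splitAt (size G) u) (splitAt (size G) v)
  where
  go : _ → _ → Bool
  go (inj₁ a) (inj₁ b) = adj G a b
  go (inj₂ a) (inj₂ b) = adj H a b
  go _        _        = false

delta : (G₁ G₂ G₃ : RawGraph) → Fin (size G₁) → Fin (size G₂) → Fin (size G₃) → RawGraph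
delta G₁ G₂ G₃ v₁ v₂ v₃ =
  mkRaw (size U) λ u v → adj U u v ∨ (inT u ∧ inT v ∧ not ⌊ u ≟ v ⌋)
  where
  U = G₁ ⊕ (G₂ ⊕ G₃)
  u₁ u₂ u₃ : Fin (size U)
  u₁ = v₁ ↑ˡ (size G₂ + size G₃)
  u₂ = size G₁ ↑ʳ (v₂ ↑ˡ size G₃)
  u₃ = size G₁ ↑ʳ (size G₂ ↑ʳ v₃)
  inT : Fin (size U) → Bool
  inT w = ⌊ w ≟ u₁ ⌋ ∨ ⌊ w ≟ u₂ ⌋ ∨ ⌊ w ≟ u₃ ⌋

InΔ : ℕ → RawGraph → Set
InΔ zero    G = G ≅ K₂
InΔ (suc k) G =
  ∃[ G₁ ] ∃[ G₂ ] ∃[ G₃ ] (InΔ k G₁ × InΔ k G₂ × InΔ k G₃ ×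
    Σ (Fin (size G₁)) λ v₁ → Σ (Fin (size G₂)) λ v₂ → Σ (Fin (size G₃)) λ v₃ →
      G ≅ delta G₁ G₂ G₃ v₁ v₂ v₃)

all : ∀ {A : Set} → (A → Bool) → List A → Bool
all p = foldr (λ x b → p x ∧ b) true

VSet : ℕ → Set
VSet n = Fin n → Bool

allSets : (n : ℕ) → List (VSet n)
allSets zero    = (λ ()) ∷ []
allSets (suc n) = concatMap (λ s → cons false s ∷ cons true s ∷ []) (allSets n)
  where
  cons : Bool → VSet n → VSet (suc n)
  cons b s zero    = b
  cons b s (suc i) = s i

∣_∣ˢ : ∀ {n} → VSet n → ℕ
∣_∣ˢ {n} S = foldr _+_ 0 (map (λ v → if S v then 1 else 0) (allFin n))

_⊆ᵇ_ : ∀ {n} → VSet n → VSet n → Bool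
_⊆ᵇ_ {n} S T = all (λ v → not (S v) ∨ T v) (allFin n)

nonemptyᵇ : ∀ {n} → VSet n → Bool
nonemptyᵇ {n} S = not (all (λ v → not (S v)) (allFin n))

rowSum : (G : RawGraph) → VSet (size G) → Fin (size G) → Bool
rowSum G T w = foldr _xor_ false (map (λ v → T v ∧ adj G v w) (allFin (size G)))

sumsToZeroᵇ : (G : RawGraph) → VSet (size G) → VSet (size G) → Bool
sumsToZeroᵇ G X T = all (λ w → X w ∨ not (rowSum G T w)) (allFin (size G))

-- the rows indexed by S are linearly independent over GF(2) in the
-- matrix A_G[X, V(G) \ X]: no nonempty subset of them sums to zero
independentᵇ : (G : RawGraph) → VSet (size G) → VSet (size G) → Bool
independentᵇ G X S =
  all (λ T → not ((T ⊆ᵇ S) ∧ nonemptyᵇ T ∧ sumsToZeroᵇ G X T)) (allSets (size G))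

maxList : List ℕ → ℕ
maxList = foldr _⊔_ 0

-- cutrk_G(X) = rank over GF(2) of A_G[X, V(G) \ X]
--            = maximum number of linearly independent rows
cutrk : (G : RawGraph) → VSet (size G) → ℕ
cutrk G X = maxList (map (λ S → if (S ⊆ᵇ X) ∧ independentᵇ G X S then ∣ S ∣ˢ else 0)
                         (allSets (size G)))

-- A linear layout (v₁,…,vₙ) is a bijection Fin n ↔ V(G), vᵢ₊₁ = π ⟨$⟩ʳ i.
Layout : RawGraph → Set
Layout G = Permutation′ (size G)

prefix : (G : RawGraph) → Layout G → ℕ → VSet (size G)
prefix G π i v = toℕ (π ⟨$⟩ˡ v) <ᵇ i

-- max over 0 ≤ i ≤ n of cutrk({v₁,…,vᵢ}); the terms i = 0, n are 0,
-- so this agrees with max_{1≤i≤n}, and is 0 when n ≤ 1.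
width : (G : RawGraph) → Layout G → ℕ
width G π = maxList (map (λ i → cutrk G (prefix G π i)) (upTo (suc (size G))))

IsLinearRankWidth : RawGraph → ℕ → Set
IsLinearRankWidth G r = (∃[ π ] width G π ≡ r) × (∀ π → r ≤ width G π)

-- Induction on k shows that every G ∈ Δ_k is connected and that, for every ordering of V(G),
-- some prefix X carries k + 1 pivots (rᵢ , cᵢ): rᵢ ∈ X, cᵢ ∉ X, rᵢcᵢ ∈ E(G) and rᵢcⱼ ∉ E(G)
-- for i < j.  They span a unitriangular submatrix of A_G[X, V(G) ∖ X], so cutrk_G(X) ≥ k + 1.
-- For a delta composition, the ordering restricts to each of the three blocks; let X be the
-- middle one of the three witnessing prefixes, taken in the whole graph.  It contains a vertex
-- of the block with the shorter prefix and misses one of the block with the longer prefix, so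
-- connectivity of those blocks, or else the triangle, yields a further crossing edge.  That
-- edge touches the middle block at most in its triangle vertex, so it can be placed before or
-- after the pivots of the middle block.
module Submission where

open import Defs hiding (sym)
open import Data.Bool using (Bool; true; false; _∧_; _∨_; not; _xor_; if_then_else_)
open import Data.Bool.Properties renaming (_≟_ to _≟ᵇ_)
  using (∧-zeroʳ; ∧-identityʳ; ∨-identityʳ; ∨-zeroʳ; xor-identityʳ; not-involutive; not-¬; ¬-not)
open import Data.Empty using (⊥-elim)
open import Data.Fin using (Fin; zero; suc; toℕ; _≟_; _↑ˡ_; _↑ʳ_; splitAt; join)
open import Data.Fin.Properties
  using (suc-injective; toℕ-injective; toℕ<n; ↑ˡ-injective; ↑ʳ-injective;
         splitAt-↑ˡ; splitAt-↑ʳ; join-splitAt; any?)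
open import Data.Fin.Permutation using (Permutation; _⟨$⟩ʳ_; _⟨$⟩ˡ_; inverseʳ; inverseˡ)
open import Data.List using (List; []; _∷_; _++_; map; foldr; length; allFin; tabulate)
open import Data.List.Properties using (map-cong; length-map; length-++-comm)
open import Data.List.Membership.Propositional using (_∈_)
open import Data.List.Membership.Propositional.Properties
  using (∈-allFin; ∈-map⁺; ∈-upTo⁺; ∈-concat⁺′)
open import Data.List.Relation.Unary.All as All using (All; []; _∷_)
import Data.List.Relation.Unary.All.Properties as Allₚ
open import Data.List.Relation.Unary.Any using (here; there)
open import Data.Nat using (ℕ; zero; suc; _+_; _≤_; _<_; _<ᵇ_; z≤n; s≤s)
open import Data.Nat.Properties
  using (<-cmp; ≤-refl; ≤-reflexive; ≤-trans; <-≤-trans; <⇒≤; ≤-total; m≤m⊔n; m≤n⊔m; +-suc;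
         module ≤-Reasoning)
import Data.Product as Prod
open import Data.Product using (∃-syntax; _×_; _,_; proj₁; proj₂)
open import Data.Sum using (inj₁; inj₂)
open import Data.Vec.Functional as Vector using (Vector)
open import Function using (_∘_; id)
open import Function.Definitions using (Injective)
open import Relation.Binary using (tri<; tri≈; tri>)
open import Relation.Nullary using (yes; no)
open import Relation.Nullary.Decidable using (⌊_⌋; isYes≗does; dec-true; dec-false; _×-dec_; ¬?)
open import Relation.Binary.PropositionalEquality

foldr-map-tabulate : ∀ {A B C : Set} (op : A → B → B) (e : B) {n} (f : C → A) (g : Fin n → C) →
                     foldr op e (map f (tabulate g)) ≡ Vector.foldr op e (f ∘ g)
foldr-map-tabulate op e {zero}  f g = refl
foldr-map-tabulate op e {suc n} f g = cong (op (f (g zero))) (foldr-map-tabulate op e f (g ∘ suc))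

xor-foldr-false : ∀ {n} (f : Vector Bool n) → (∀ v → f v ≡ false) →
                  Vector.foldr _xor_ false f ≡ false
xor-foldr-false {zero}  f f≡false = refl
xor-foldr-false {suc n} f f≡false rewrite f≡false zero = xor-foldr-false (f ∘ suc) (f≡false ∘ suc)

xor-foldr-single : ∀ {n} (f : Vector Bool n) r → (∀ v → v ≢ r → f v ≡ false) →
                   Vector.foldr _xor_ false f ≡ f r
xor-foldr-single f zero others =
  trans (cong (f zero xor_) (xor-foldr-false (f ∘ suc) (λ v → others (suc v) λ ())))
        (xor-identityʳ (f zero))
xor-foldr-single f (suc r) others rewrite others zero (λ ()) =
  xor-foldr-single (f ∘ suc) r (λ v v≢r → others (suc v) (v≢r ∘ suc-injective))

foldr-cong : ∀ {A B : Set} (op : A → B → B) (e : B) {n} {f g : Vector A n} →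
             (∀ i → f i ≡ g i) → Vector.foldr op e f ≡ Vector.foldr op e g
foldr-cong op e {zero}  f≗g = refl
foldr-cong op e {suc n} f≗g = cong₂ op (f≗g zero) (foldr-cong op e (f≗g ∘ suc))

+-foldr-insert : ∀ {n} (f g : Vector ℕ n) r → f r ≡ suc (g r) → (∀ v → v ≢ r → f v ≡ g v) →
                 Vector.foldr _+_ 0 f ≡ suc (Vector.foldr _+_ 0 g)
+-foldr-insert f g zero fr others rewrite fr =
  cong (λ s → suc (g zero + s)) (foldr-cong _+_ 0 (λ v → others (suc v) λ ()))
+-foldr-insert f g (suc r) fr others rewrite others zero (λ ()) =
  trans (cong (g zero +_) (+-foldr-insert (f ∘ suc) (g ∘ suc) r fr
                                          (λ v v≢r → others (suc v) (v≢r ∘ suc-injective))))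
        (+-suc (g zero) _)

not-flip : ∀ {b c} → not b ≡ c → b ≡ not c
not-flip {b} e = trans (sym (not-involutive b)) (cong not e)

⌊≟⌋-refl : ∀ {n} (v : Fin n) → ⌊ v ≟ v ⌋ ≡ true
⌊≟⌋-refl v = trans (isYes≗does (v ≟ v)) (dec-true (v ≟ v) refl)

⌊≟⌋-≢ : ∀ {n} {v w : Fin n} → v ≢ w → ⌊ v ≟ w ⌋ ≡ false
⌊≟⌋-≢ {v = v} {w} v≢w = trans (isYes≗does (v ≟ w)) (dec-false (v ≟ w) v≢w)

module _ {A : Set} (p : A → Bool) where

  all⁺ : ∀ xs → (∀ x → p x ≡ true) → all p xs ≡ true
  all⁺ []       px = refl
  all⁺ (x ∷ xs) px rewrite px x = all⁺ xs px

  all⁻ : ∀ {xs x} → all p xs ≡ true → x ∈ xs → p x ≡ true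
  all⁻ {y ∷ xs} e (here refl) with p y
  ... | true = refl
  all⁻ {y ∷ xs} e (there x∈) with p y
  ... | true = all⁻ e x∈

  all-false⁺ : ∀ {xs x} → x ∈ xs → p x ≡ false → all p xs ≡ false
  all-false⁺ (here refl) px rewrite px = refl
  all-false⁺ {y ∷ xs} (there x∈) px with p y
  ... | true  = all-false⁺ x∈ px
  ... | false = refl

  all-false⁻ : ∀ xs → all p xs ≡ false → ∃[ x ] p x ≡ false
  all-false⁻ (y ∷ xs) e with p y in py
  ... | true  = all-false⁻ xs e
  ... | false = y , py

allSets-complete : ∀ n (S : VSet n) → ∃[ S′ ] (S′ ∈ allSets n × (∀ v → S′ v ≡ S v))
allSets-complete zero    S = _ , here refl , λ ()
allSets-complete (suc n) S with allSets-complete n (S ∘ suc) | S zero in S₀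
... | S′ , S′∈ , S′≗S | false =
  _ , ∈-concat⁺′ (here refl) (∈-map⁺ _ S′∈) , λ { zero → sym S₀ ; (suc v) → S′≗S v }
... | S′ , S′∈ , S′≗S | true =
  _ , ∈-concat⁺′ (there (here refl)) (∈-map⁺ _ S′∈) , λ { zero → sym S₀ ; (suc v) → S′≗S v }

≤-maxList : ∀ {x xs} → x ∈ xs → x ≤ maxList xs
≤-maxList {xs = y ∷ _} (here refl) = m≤m⊔n y _
≤-maxList {xs = y ∷ _} (there x∈)  = ≤-trans (≤-maxList x∈) (m≤n⊔m y _)

_⊆_ : ∀ {n} → VSet n → VSet n → Set
S ⊆ T = ∀ {v} → S v ≡ true → T v ≡ true

⊆ᵇ-intro : ∀ {n} {S T : VSet n} → S ⊆ T → (S ⊆ᵇ T) ≡ true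
⊆ᵇ-intro {n} {S} {T} S⊆T = all⁺ _ (allFin n) pointwise
  where
  pointwise : ∀ v → (not (S v) ∨ T v) ≡ true
  pointwise v with S v in Sv
  ... | true  = S⊆T Sv
  ... | false = refl

⊆ᵇ-elim : ∀ {n} {S T : VSet n} → (S ⊆ᵇ T) ≡ true → S ⊆ T
⊆ᵇ-elim {S = S} S⊆ᵇT {v} Sv with all⁻ _ S⊆ᵇT (∈-allFin v)
... | ¬Sv∨Tv rewrite Sv = ¬Sv∨Tv

nonemptyᵇ-elim : ∀ {n} (S : VSet n) → nonemptyᵇ S ≡ true → ∃[ v ] S v ≡ true
nonemptyᵇ-elim {n} S ne with all-false⁻ (not ∘ S) (allFin n) (not-flip ne)
... | v , ¬Sv≡false = v , not-flip ¬Sv≡false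

∣∣ˢ-cong : ∀ {n} {S S′ : VSet n} → (∀ v → S v ≡ S′ v) → ∣ S ∣ˢ ≡ ∣ S′ ∣ˢ
∣∣ˢ-cong {n} S≗S′ =
  cong (foldr _+_ 0) (map-cong (λ v → cong (λ b → if b then 1 else 0) (S≗S′ v)) (allFin n))

∣∣ˢ-insert : ∀ {n} (S S′ : VSet n) r → S r ≡ true → S′ r ≡ false → (∀ v → v ≢ r → S v ≡ S′ v) →
             ∣ S ∣ˢ ≡ suc ∣ S′ ∣ˢ
∣∣ˢ-insert S S′ r Sr S′r others = begin
  ∣ S ∣ˢ                                  ≡⟨ foldr-map-tabulate _+_ 0 (indicator S) id ⟩
  Vector.foldr _+_ 0 (indicator S)        ≡⟨ +-foldr-insert _ _ r one-more (λ v → cong ind ∘ others v) ⟩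
  suc (Vector.foldr _+_ 0 (indicator S′)) ≡⟨ cong suc (foldr-map-tabulate _+_ 0 (indicator S′) id) ⟨
  suc ∣ S′ ∣ˢ                             ∎
  where
  open ≡-Reasoning
  ind : Bool → ℕ
  ind b = if b then 1 else 0
  indicator : VSet _ → Vector ℕ _
  indicator T = ind ∘ T
  one-more : indicator S r ≡ suc (indicator S′ r)
  one-more rewrite Sr | S′r = refl

Independent : (G : RawGraph) → VSet (size G) → VSet (size G) → Set
Independent G X S =
  ∀ T → T ⊆ S → ∀ {v} → T v ≡ true → ∃[ w ] (X w ≡ false × rowSum G T w ≡ true)

independentᵇ-intro : ∀ G {X S} → Independent G X S → independentᵇ G X S ≡ true
independentᵇ-intro G {X} {S} indep = all⁺ _ (allSets (size G)) no-zero-sum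
  where
  no-zero-sum : ∀ T → not ((T ⊆ᵇ S) ∧ nonemptyᵇ T ∧ sumsToZeroᵇ G X T) ≡ true
  no-zero-sum T with T ⊆ᵇ S in T⊆S | nonemptyᵇ T in T≢∅
  ... | false | _     = refl
  ... | true  | false = refl
  ... | true  | true with nonemptyᵇ-elim T T≢∅
  ... | v , Tv with indep T (⊆ᵇ-elim {S = T} {T = S} T⊆S) Tv
  ... | w , w∉X , odd = cong not (all-false⁺ (λ u → X u ∨ not (rowSum G T u)) (∈-allFin w) nonzero)
    where
    nonzero : (X w ∨ not (rowSum G T w)) ≡ false
    nonzero rewrite w∉X | odd = refl

∣∣ˢ≤cutrk : ∀ G {X S} → S ⊆ X → Independent G X S → ∣ S ∣ˢ ≤ cutrk G X
∣∣ˢ≤cutrk G {X} {S} S⊆X indep with allSets-complete (size G) S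
... | S′ , S′∈ , S′≗S = begin
  ∣ S ∣ˢ  ≡⟨ ∣∣ˢ-cong (sym ∘ S′≗S) ⟩
  ∣ S′ ∣ˢ ≡⟨ value ⟨
  (if (S′ ⊆ᵇ X) ∧ independentᵇ G X S′ then ∣ S′ ∣ˢ else 0) ≤⟨ ≤-maxList (∈-map⁺ _ S′∈) ⟩
  cutrk G X ∎
  where
  open ≤-Reasoning
  S′⊆S : S′ ⊆ S
  S′⊆S {v} S′v = trans (sym (S′≗S v)) S′v
  value : (if (S′ ⊆ᵇ X) ∧ independentᵇ G X S′ then ∣ S′ ∣ˢ else 0) ≡ ∣ S′ ∣ˢ
  value = cong (λ b → if b then ∣ S′ ∣ˢ else 0)
               (cong₂ _∧_ (⊆ᵇ-intro {S = S′} {T = X} (λ S′v → S⊆X (S′⊆S S′v)))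
                          (independentᵇ-intro G λ T T⊆S′ → indep T (λ Tv → S′⊆S (T⊆S′ Tv))))

-- Triangular pivot systems

rowSum-cong : ∀ G {T T′ w} → (∀ v → (T v ∧ adj G v w) ≡ (T′ v ∧ adj G v w)) →
              rowSum G T w ≡ rowSum G T′ w
rowSum-cong G pointwise = cong (foldr _xor_ false) (map-cong pointwise (allFin (size G)))

rowSum-single : ∀ G {T} r {w} → (∀ v → v ≢ r → T v ≡ false) → rowSum G T w ≡ (T r ∧ adj G r w)
rowSum-single G {T} r {w} others =
  trans (foldr-map-tabulate _xor_ false (λ v → T v ∧ adj G v w) id)
        (xor-foldr-single _ r (λ v v≢r → cong (_∧ adj G v w) (others v v≢r)))

Pivot : ℕ → Set
Pivot n = Fin n × Fin n

-- Pivots (r₁ , c₁) … (rₘ , cₘ) of an upper unitriangular submatrix of A_G[X, V(G) ∖ X].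
data Triangular (G : RawGraph) (X : VSet (size G)) : List (Pivot (size G)) → Set where
  [] : Triangular G X []
  pivot : ∀ {r c L} → X r ≡ true → X c ≡ false → adj G r c ≡ true →
          All (λ p → adj G r (proj₂ p) ≡ false) L → Triangular G X L →
          Triangular G X ((r , c) ∷ L)

pivotRows : ∀ {n} → List (Pivot n) → VSet n
pivotRows []            v = false
pivotRows ((r , _) ∷ L) v = ⌊ v ≟ r ⌋ ∨ pivotRows L v

module _ {G : RawGraph} {X : VSet (size G)} where

  Triangular-rows : ∀ {L} → Triangular G X L → All (λ p → X (proj₁ p) ≡ true) L
  Triangular-rows []                      = []
  Triangular-rows (pivot r∈X _ _ _ tri) = r∈X ∷ Triangular-rows tri

  Triangular-columns : ∀ {L} → Triangular G X L → All (λ p → X (proj₂ p) ≡ false) L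
  Triangular-columns []                      = []
  Triangular-columns (pivot _ c∉X _ _ tri) = c∉X ∷ Triangular-columns tri

  Triangular-sides : ∀ {L} → Triangular G X L → 0 < length L →
                     ∃[ r ] ∃[ c ] (X r ≡ true × X c ≡ false)
  Triangular-sides (pivot r∈X c∉X _ _ _) _ = _ , _ , r∈X , c∉X

  pivotRows⊆X : ∀ {L} → Triangular G X L → pivotRows L ⊆ X
  pivotRows⊆X {(r , _) ∷ _} (pivot r∈X _ _ _ tri) {v} v∈ with v ≟ r
  ... | yes refl = r∈X
  ... | no _     = pivotRows⊆X tri v∈

  pivotRows-fresh : ∀ {r L} → Triangular G X L → All (λ p → adj G r (proj₂ p) ≡ false) L →
                    pivotRows L r ≡ false
  pivotRows-fresh []                               []                 = refl
  pivotRows-fresh {r} {(r′ , _) ∷ _} (pivot _ _ r′c′ _ tri) (rc′∉E ∷ clear) with r ≟ r′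
  ... | yes refl = ⊥-elim (not-¬ r′c′ rc′∉E)
  ... | no _     = pivotRows-fresh tri clear

  length≤∣pivotRows∣ : ∀ {L} → Triangular G X L → length L ≤ ∣ pivotRows L ∣ˢ
  length≤∣pivotRows∣ [] = z≤n
  length≤∣pivotRows∣ {(r , c) ∷ L} (pivot _ _ _ clear tri) = begin
    suc (length L)           ≤⟨ s≤s (length≤∣pivotRows∣ tri) ⟩
    suc ∣ pivotRows L ∣ˢ       ≡⟨ ∣∣ˢ-insert _ _ r r∈ (pivotRows-fresh tri clear) others ⟨
    ∣ pivotRows ((r , c) ∷ L) ∣ˢ ∎
    where
    open ≤-Reasoning
    r∈ : pivotRows ((r , c) ∷ L) r ≡ true
    r∈ = cong (_∨ pivotRows L r) (⌊≟⌋-refl r)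
    others : ∀ v → v ≢ r → pivotRows ((r , c) ∷ L) v ≡ pivotRows L v
    others v v≢r = cong (_∨ pivotRows L v) (⌊≟⌋-≢ v≢r)

  Triangular-snoc : ∀ {L r c} → Triangular G X L → All (λ p → adj G (proj₁ p) c ≡ false) L →
                    X r ≡ true → X c ≡ false → adj G r c ≡ true → Triangular G X (L ++ (r , c) ∷ [])
  Triangular-snoc [] [] r∈X c∉X rc∈E = pivot r∈X c∉X rc∈E [] []
  Triangular-snoc (pivot r′∈X c′∉X r′c′∈E clear tri) (r′c∉E ∷ rows-clear) r∈X c∉X rc∈E =
    pivot r′∈X c′∉X r′c′∈E (Allₚ.∷ʳ⁺ clear r′c∉E) (Triangular-snoc tri rows-clear r∈X c∉X rc∈E)

  -- The last pivot whose row lies in T has a column meeting T only in that row, since every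
  -- earlier pivot row is 0 there.
  pivot-column : ∀ {L} → Triangular G X L → ∀ T → T ⊆ pivotRows L → ∀ {v₀} → T v₀ ≡ true →
                 ∃[ p ] (p ∈ L × rowSum G T (proj₂ p) ≡ true)
  pivot-column [] T T⊆ Tv₀ with () ← T⊆ Tv₀
  pivot-column {(r , c) ∷ L} (pivot _ _ rc∈E clear tri) T T⊆ {v₀} Tv₀
    with any? (λ v → (T v ≟ᵇ true) ×-dec ¬? (v ≟ r))
  ... | no only-r = (r , c) , here refl , trans (rowSum-single G r off) (cong₂ _∧_ Tr rc∈E)
    where
    off : ∀ v → v ≢ r → T v ≡ false
    off v v≢r with T v in Tv
    ... | true  = ⊥-elim (only-r (v , Tv , v≢r))
    ... | false = refl
    Tr : T r ≡ true
    Tr with v₀ ≟ r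
    ... | yes refl = Tv₀
    ... | no v₀≢r  = ⊥-elim (not-¬ Tv₀ (off v₀ v₀≢r))
  ... | yes (v₁ , Tv₁ , v₁≢r) =
    let (p , p∈ , odd) = pivot-column tri T′ T′⊆ T′v₁ in
    p , there p∈ , trans (rowSum-cong G (same-terms (All.lookup clear p∈))) odd
    where
    T′ : VSet (size G)
    T′ v = T v ∧ not ⌊ v ≟ r ⌋
    T′⊆ : T′ ⊆ pivotRows L
    T′⊆ {v} T′v with v ≟ r | T v in Tv
    ... | no v≢r | true = trans (sym (cong (_∨ pivotRows L v) (⌊≟⌋-≢ v≢r))) (T⊆ Tv)
    T′⊆ {v} () | yes _ | true
    T′⊆ {v} () | _ | false
    T′v₁ : T′ v₁ ≡ true
    T′v₁ = cong₂ _∧_ Tv₁ (cong not (⌊≟⌋-≢ v₁≢r))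
    same-terms : ∀ {w} → adj G r w ≡ false → ∀ v → (T v ∧ adj G v w) ≡ (T′ v ∧ adj G v w)
    same-terms rw∉E v with v ≟ r
    ... | yes refl rewrite rw∉E = trans (∧-zeroʳ (T v)) (sym (∧-zeroʳ (T v ∧ false)))
    ... | no _     = cong (_∧ _) (sym (∧-identityʳ (T v)))

  Triangular⇒Independent : ∀ {L} → Triangular G X L → Independent G X (pivotRows L)
  Triangular⇒Independent tri T T⊆ Tv with pivot-column tri T T⊆ Tv
  ... | p , p∈ , odd = proj₂ p , All.lookup (Triangular-columns tri) p∈ , odd

  Triangular⇒≤cutrk : ∀ {L} → Triangular G X L → length L ≤ cutrk G X
  Triangular⇒≤cutrk tri =
    ≤-trans (length≤∣pivotRows∣ tri) (∣∣ˢ≤cutrk G (pivotRows⊆X tri) (Triangular⇒Independent tri))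

Triangular-map : ∀ {A B} (f : Fin (size A) → Fin (size B)) →
                 (∀ a a′ → adj B (f a) (f a′) ≡ adj A a a′) →
                 ∀ {X L} → Triangular A (X ∘ f) L → Triangular B X (map (Prod.map f f) L)
Triangular-map f f-adj [] = []
Triangular-map f f-adj (pivot r∈X c∉X rc∈E clear tri) =
  pivot r∈X c∉X (trans (f-adj _ _) rc∈E) (Allₚ.map⁺ (All.map (trans (f-adj _ _)) clear))
        (Triangular-map f f-adj tri)

-- The inductive invariant

below : ∀ {n} → (Fin n → ℕ) → ℕ → VSet n
below pos t v = pos v <ᵇ t

<ᵇ≡true : ∀ {m n} → m < n → (m <ᵇ n) ≡ true
<ᵇ≡true {zero}  (s≤s _)   = refl
<ᵇ≡true {suc m} (s≤s m<n) = <ᵇ≡true m<n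

<ᵇ≡false : ∀ {m n} → n ≤ m → (m <ᵇ n) ≡ false
<ᵇ≡false {n = zero}      _         = refl
<ᵇ≡false {suc m} {suc n} (s≤s n≤m) = <ᵇ≡false n≤m

<ᵇ≡true⁻ : ∀ m n → (m <ᵇ n) ≡ true → m < n
<ᵇ≡true⁻ zero    (suc n) _ = s≤s z≤n
<ᵇ≡true⁻ (suc m) (suc n) e = s≤s (<ᵇ≡true⁻ m n e)

<ᵇ≡false⁻ : ∀ m n → (m <ᵇ n) ≡ false → n ≤ m
<ᵇ≡false⁻ m       zero    _ = z≤n
<ᵇ≡false⁻ (suc m) (suc n) e = s≤s (<ᵇ≡false⁻ m n e)

-- Orderings are given by injective positions so that they restrict to the blocks of a
-- delta composition and transfer along isomorphisms.
EveryOrderHasPivots : ℕ → RawGraph → Set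
EveryOrderHasPivots k H = ∀ (pos : Fin (size H) → ℕ) → Injective _≡_ _≡_ pos →
  ∃[ t ] ∃[ L ] (Triangular H (below pos t) L × k < length L)

CrossingEdge : (H : RawGraph) → VSet (size H) → Set
CrossingEdge H X = ∃[ a ] ∃[ b ] (X a ≡ true × X b ≡ false × adj H a b ≡ true)

Connected : RawGraph → Set
Connected H = ∀ (X : VSet (size H)) {u w} → X u ≡ true → X w ≡ false → CrossingEdge H X

CrossingEdge-map : ∀ {A B} (f : Fin (size A) → Fin (size B)) →
                   (∀ a a′ → adj B (f a) (f a′) ≡ adj A a a′) →
                   ∀ {X} → CrossingEdge A (X ∘ f) → CrossingEdge B X
CrossingEdge-map f f-adj (a , b , a∈X , b∉X , ab∈E) = f a , f b , a∈X , b∉X , trans (f-adj a b) ab∈E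

separated : ∀ {n} (X : VSet n) {p q} → X p ≡ true → X q ≡ false → p ≢ q
separated X Xp Xq refl = not-¬ Xp Xq

⟨$⟩ˡ-injective : ∀ {m n} (π : Permutation m n) → Injective _≡_ _≡_ (π ⟨$⟩ˡ_)
⟨$⟩ˡ-injective π {a} {b} eq = trans (sym (inverseʳ π)) (trans (cong (π ⟨$⟩ʳ_) eq) (inverseʳ π))

module _ {H D : RawGraph} (H≅D : H ≅ D) where
  private
    π : Permutation (size H) (size D)
    π = proj₁ H≅D
    π⁻¹ : Fin (size D) → Fin (size H)
    π⁻¹ = π ⟨$⟩ˡ_

  adj-π⁻¹ : ∀ a b → adj H (π⁻¹ a) (π⁻¹ b) ≡ adj D a b
  adj-π⁻¹ a b = trans (sym (proj₂ H≅D (π⁻¹ a) (π⁻¹ b))) (cong₂ (adj D) (inverseʳ π) (inverseʳ π))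

  EveryOrderHasPivots-≅ : ∀ {k} → EveryOrderHasPivots k D → EveryOrderHasPivots k H
  EveryOrderHasPivots-≅ pivots pos pos-inj =
    let (t , L , tri , k<L) = pivots (pos ∘ π⁻¹) (λ e → ⟨$⟩ˡ-injective π (pos-inj e)) in
    t , map (Prod.map π⁻¹ π⁻¹) L , Triangular-map π⁻¹ adj-π⁻¹ tri ,
    subst (_ <_) (sym (length-map _ L)) k<L

  Connected-≅ : Connected D → Connected H
  Connected-≅ conn X u∈X w∉X =
    CrossingEdge-map π⁻¹ adj-π⁻¹
      (conn (X ∘ π⁻¹) (trans (cong X (inverseˡ π)) u∈X) (trans (cong X (inverseˡ π)) w∉X))

edge-pivot : ∀ {G} (pos : Fin (size G) → ℕ) {u w} → adj G u w ≡ true → pos u < pos w →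
             Triangular G (below pos (suc (pos u))) ((u , w) ∷ [])
edge-pivot pos {u} uw∈E pu<pw = pivot (<ᵇ≡true {pos u} ≤-refl) (<ᵇ≡false pu<pw) uw∈E [] []

EveryOrderHasPivots-K₂ : EveryOrderHasPivots 0 K₂
EveryOrderHasPivots-K₂ pos pos-inj with <-cmp (pos zero) (pos (suc zero))
... | tri< p₀<p₁ _ _ = suc (pos zero) , _ , edge-pivot pos refl p₀<p₁ , s≤s z≤n
... | tri≈ _ p₀≡p₁ _ with () ← pos-inj p₀≡p₁
... | tri> _ _ p₁<p₀ = suc (pos (suc zero)) , _ , edge-pivot pos refl p₁<p₀ , s≤s z≤n

Connected-K₂ : Connected K₂
Connected-K₂ X {zero}     {zero}     u∈X u∉X = ⊥-elim (not-¬ u∈X u∉X)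
Connected-K₂ X {zero}     {suc zero} u∈X w∉X = _ , _ , u∈X , w∉X , refl
Connected-K₂ X {suc zero} {zero}     u∈X w∉X = _ , _ , u∈X , w∉X , refl
Connected-K₂ X {suc zero} {suc zero} u∈X u∉X = ⊥-elim (not-¬ u∈X u∉X)

-- Delta compositions

module _ (A B : RawGraph) where

  adj-⊕-↑ˡ↑ˡ : ∀ x y → adj (A ⊕ B) (x ↑ˡ size B) (y ↑ˡ size B) ≡ adj A x y
  adj-⊕-↑ˡ↑ˡ x y rewrite splitAt-↑ˡ (size A) x (size B) | splitAt-↑ˡ (size A) y (size B) = refl

  adj-⊕-↑ʳ↑ʳ : ∀ x y → adj (A ⊕ B) (size A ↑ʳ x) (size A ↑ʳ y) ≡ adj B x y
  adj-⊕-↑ʳ↑ʳ x y rewrite splitAt-↑ʳ (size A) (size B) x | splitAt-↑ʳ (size A) (size B) y = refl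

  adj-⊕-↑ˡ↑ʳ : ∀ x y → adj (A ⊕ B) (x ↑ˡ size B) (size A ↑ʳ y) ≡ false
  adj-⊕-↑ˡ↑ʳ x y rewrite splitAt-↑ˡ (size A) x (size B) | splitAt-↑ʳ (size A) (size B) y = refl

  adj-⊕-↑ʳ↑ˡ : ∀ x y → adj (A ⊕ B) (size A ↑ʳ x) (y ↑ˡ size B) ≡ false
  adj-⊕-↑ʳ↑ˡ x y rewrite splitAt-↑ʳ (size A) (size B) x | splitAt-↑ˡ (size A) y (size B) = refl

↑ˡ≢↑ʳ : ∀ {m n} (x : Fin m) (y : Fin n) → x ↑ˡ n ≢ m ↑ʳ y
↑ˡ≢↑ʳ {m} {n} x y eq
  with () ← trans (sym (splitAt-↑ˡ m x n)) (trans (cong (splitAt m) eq) (splitAt-↑ʳ m n y))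

join-of-splitAt : ∀ {m n} {p : Fin (m + n)} {s} → splitAt m p ≡ s → join m n s ≡ p
join-of-splitAt {m} {n} {p} refl = join-splitAt m n p

data Block : Set where
  B₁ B₂ B₃ : Block

middle : (T : Block → ℕ) →
         ∃[ i ] ∃[ j ] ∃[ l ] (i ≢ j × i ≢ l × j ≢ l × T j ≤ T i × T i ≤ T l)
middle T with ≤-total (T B₁) (T B₂) | ≤-total (T B₂) (T B₃) | ≤-total (T B₁) (T B₃)
... | inj₁ 1≤2 | inj₁ 2≤3 | _        = B₂ , B₁ , B₃ , (λ ()) , (λ ()) , (λ ()) , 1≤2 , 2≤3
... | inj₁ 1≤2 | inj₂ 3≤2 | inj₁ 1≤3 = B₃ , B₁ , B₂ , (λ ()) , (λ ()) , (λ ()) , 1≤3 , 3≤2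
... | inj₁ 1≤2 | inj₂ 3≤2 | inj₂ 3≤1 = B₁ , B₃ , B₂ , (λ ()) , (λ ()) , (λ ()) , 3≤1 , 1≤2
... | inj₂ 2≤1 | _        | inj₁ 1≤3 = B₁ , B₂ , B₃ , (λ ()) , (λ ()) , (λ ()) , 2≤1 , 1≤3
... | inj₂ 2≤1 | inj₁ 2≤3 | inj₂ 3≤1 = B₃ , B₂ , B₁ , (λ ()) , (λ ()) , (λ ()) , 2≤3 , 3≤1
... | inj₂ 2≤1 | inj₂ 3≤2 | inj₂ 3≤1 = B₂ , B₃ , B₁ , (λ ()) , (λ ()) , (λ ()) , 3≤2 , 2≤1

module DeltaComposition (G₁ G₂ G₃ : RawGraph)
                        (v₁ : Fin (size G₁)) (v₂ : Fin (size G₂)) (v₃ : Fin (size G₃)) where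

  D : RawGraph
  D = delta G₁ G₂ G₃ v₁ v₂ v₃

  Gᵇ : Block → RawGraph
  Gᵇ B₁ = G₁
  Gᵇ B₂ = G₂
  Gᵇ B₃ = G₃

  vᵇ : ∀ b → Fin (size (Gᵇ b))
  vᵇ B₁ = v₁
  vᵇ B₂ = v₂
  vᵇ B₃ = v₃

  ι : ∀ b → Fin (size (Gᵇ b)) → Fin (size D)
  ι B₁ x = x ↑ˡ (size G₂ + size G₃)
  ι B₂ x = size G₁ ↑ʳ (x ↑ˡ size G₃)
  ι B₃ x = size G₁ ↑ʳ (size G₂ ↑ʳ x)

  τ : Block → Fin (size D)
  τ b = ι b (vᵇ b)

  onTriangle : Fin (size D) → Bool
  onTriangle w = ⌊ w ≟ τ B₁ ⌋ ∨ ⌊ w ≟ τ B₂ ⌋ ∨ ⌊ w ≟ τ B₃ ⌋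

  ι-injective : ∀ b → Injective _≡_ _≡_ (ι b)
  ι-injective B₁ eq = ↑ˡ-injective _ _ _ eq
  ι-injective B₂ eq = ↑ˡ-injective _ _ _ (↑ʳ-injective (size G₁) _ _ eq)
  ι-injective B₃ eq = ↑ʳ-injective (size G₂) _ _ (↑ʳ-injective (size G₁) _ _ eq)

  ι-block : ∀ {b b′ x y} → ι b x ≡ ι b′ y → b ≡ b′
  ι-block {B₁} {B₁} eq = refl
  ι-block {B₁} {B₂} eq = ⊥-elim (↑ˡ≢↑ʳ _ _ eq)
  ι-block {B₁} {B₃} eq = ⊥-elim (↑ˡ≢↑ʳ _ _ eq)
  ι-block {B₂} {B₁} eq = ⊥-elim (↑ˡ≢↑ʳ _ _ (sym eq))
  ι-block {B₂} {B₂} eq = refl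
  ι-block {B₂} {B₃} eq = ⊥-elim (↑ˡ≢↑ʳ _ _ (↑ʳ-injective (size G₁) _ _ eq))
  ι-block {B₃} {B₁} eq = ⊥-elim (↑ˡ≢↑ʳ _ _ (sym eq))
  ι-block {B₃} {B₂} eq = ⊥-elim (↑ˡ≢↑ʳ _ _ (sym (↑ʳ-injective (size G₁) _ _ eq)))
  ι-block {B₃} {B₃} eq = refl

  ι-surjective : ∀ p → ∃[ b ] ∃[ x ] ι b x ≡ p
  ι-surjective p with splitAt (size G₁) p in split₁
  ... | inj₁ x = B₁ , x , join-of-splitAt split₁
  ... | inj₂ q with splitAt (size G₂) q in split₂
  ... | inj₁ y = B₂ , y , trans (cong (size G₁ ↑ʳ_) (join-of-splitAt split₂))
                                (join-of-splitAt split₁)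
  ... | inj₂ z = B₃ , z , trans (cong (size G₁ ↑ʳ_) (join-of-splitAt split₂))
                                (join-of-splitAt split₁)

  private
    U : RawGraph
    U = G₁ ⊕ (G₂ ⊕ G₃)

  adj-U-ι : ∀ b x y → adj U (ι b x) (ι b y) ≡ adj (Gᵇ b) x y
  adj-U-ι B₁ x y = adj-⊕-↑ˡ↑ˡ G₁ (G₂ ⊕ G₃) x y
  adj-U-ι B₂ x y = trans (adj-⊕-↑ʳ↑ʳ G₁ (G₂ ⊕ G₃) _ _) (adj-⊕-↑ˡ↑ˡ G₂ G₃ x y)
  adj-U-ι B₃ x y = trans (adj-⊕-↑ʳ↑ʳ G₁ (G₂ ⊕ G₃) _ _) (adj-⊕-↑ʳ↑ʳ G₂ G₃ x y)

  adj-U-ι-ι : ∀ {b b′} → b ≢ b′ → ∀ x y → adj U (ι b x) (ι b′ y) ≡ false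
  adj-U-ι-ι {B₁} {B₁} b≢b′ x y = ⊥-elim (b≢b′ refl)
  adj-U-ι-ι {B₁} {B₂} b≢b′ x y = adj-⊕-↑ˡ↑ʳ G₁ (G₂ ⊕ G₃) x _
  adj-U-ι-ι {B₁} {B₃} b≢b′ x y = adj-⊕-↑ˡ↑ʳ G₁ (G₂ ⊕ G₃) x _
  adj-U-ι-ι {B₂} {B₁} b≢b′ x y = adj-⊕-↑ʳ↑ˡ G₁ (G₂ ⊕ G₃) _ y
  adj-U-ι-ι {B₂} {B₂} b≢b′ x y = ⊥-elim (b≢b′ refl)
  adj-U-ι-ι {B₂} {B₃} b≢b′ x y = trans (adj-⊕-↑ʳ↑ʳ G₁ (G₂ ⊕ G₃) _ _) (adj-⊕-↑ˡ↑ʳ G₂ G₃ x y)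
  adj-U-ι-ι {B₃} {B₁} b≢b′ x y = adj-⊕-↑ʳ↑ˡ G₁ (G₂ ⊕ G₃) _ y
  adj-U-ι-ι {B₃} {B₂} b≢b′ x y = trans (adj-⊕-↑ʳ↑ʳ G₁ (G₂ ⊕ G₃) _ _) (adj-⊕-↑ʳ↑ˡ G₂ G₃ x y)
  adj-U-ι-ι {B₃} {B₃} b≢b′ x y = ⊥-elim (b≢b′ refl)

  ι≡τ⇒ : ∀ {b x} b′ → ι b x ≡ τ b′ → x ≡ vᵇ b
  ι≡τ⇒ {b} b′ eq with ι-block {b} {b′} eq
  ... | refl = ι-injective b eq

  onTriangle-ι : ∀ b x → onTriangle (ι b x) ≡ true → x ≡ vᵇ b
  onTriangle-ι b x on with ι b x ≟ τ B₁ | ι b x ≟ τ B₂ | ι b x ≟ τ B₃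
  ... | yes eq | _      | _      = ι≡τ⇒ B₁ eq
  ... | no _   | yes eq | _      = ι≡τ⇒ B₂ eq
  ... | no _   | no _   | yes eq = ι≡τ⇒ B₃ eq
  onTriangle-ι b x () | no _ | no _ | no _

  onTriangle-τ : ∀ b → onTriangle (τ b) ≡ true
  onTriangle-τ B₁ rewrite ⌊≟⌋-refl (τ B₁) = refl
  onTriangle-τ B₂ rewrite ⌊≟⌋-refl (τ B₂) = ∨-zeroʳ _
  onTriangle-τ B₃ rewrite ⌊≟⌋-refl (τ B₃) =
    trans (cong (⌊ τ B₃ ≟ τ B₁ ⌋ ∨_) (∨-zeroʳ ⌊ τ B₃ ≟ τ B₂ ⌋)) (∨-zeroʳ _)

  adj-ι : ∀ b x y → adj D (ι b x) (ι b y) ≡ adj (Gᵇ b) x y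
  adj-ι b x y = trans (cong₂ _∨_ (adj-U-ι b x y) no-triangle-edge) (∨-identityʳ _)
    where
    no-triangle-edge : (onTriangle (ι b x) ∧ onTriangle (ι b y) ∧ not ⌊ ι b x ≟ ι b y ⌋) ≡ false
    no-triangle-edge with onTriangle (ι b x) in x-on | onTriangle (ι b y) in y-on
    ... | false | _     = refl
    ... | true  | false = refl
    ... | true  | true rewrite onTriangle-ι b x x-on | onTriangle-ι b y y-on | ⌊≟⌋-refl (τ b) = refl

  adj-ι-ι : ∀ {b b′} → b ≢ b′ → ∀ {x y} → adj D (ι b x) (ι b′ y) ≡ true → x ≡ vᵇ b × y ≡ vᵇ b′
  adj-ι-ι {b} {b′} b≢b′ {x} {y} xy∈E rewrite adj-U-ι-ι b≢b′ x y
    with onTriangle (ι b x) in x-on | onTriangle (ι b′ y) in y-on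
  ... | true  | true = onTriangle-ι b x x-on , onTriangle-ι b′ y y-on
  adj-ι-ι b≢b′ () | true  | false
  adj-ι-ι b≢b′ () | false | _

  adj-τ-τ : ∀ {b b′} → b ≢ b′ → adj D (τ b) (τ b′) ≡ true
  adj-τ-τ {b} {b′} b≢b′
    rewrite adj-U-ι-ι b≢b′ (vᵇ b) (vᵇ b′) | onTriangle-τ b | onTriangle-τ b′
          | ⌊≟⌋-≢ {v = τ b} {τ b′} (b≢b′ ∘ ι-block) = refl

  adj-ι-ι-offˡ : ∀ {b b′} → b ≢ b′ → ∀ {x y} → x ≢ vᵇ b → adj D (ι b x) (ι b′ y) ≡ false
  adj-ι-ι-offˡ b≢b′ x≢v = ¬-not (x≢v ∘ proj₁ ∘ adj-ι-ι b≢b′)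

  adj-ι-ι-offʳ : ∀ {b b′} → b ≢ b′ → ∀ {x y} → y ≢ vᵇ b′ → adj D (ι b x) (ι b′ y) ≡ false
  adj-ι-ι-offʳ b≢b′ y≢v = ¬-not (y≢v ∘ proj₂ ∘ adj-ι-ι b≢b′)

  Connected-D : (∀ b → Connected (Gᵇ b)) → Connected D
  Connected-D conn X {u} {w} u∈X w∉X with ι-surjective u | ι-surjective w
  ... | b , x , refl | b′ , y , refl with X (τ b) in τb∈X | X (τ b′) in τb′∈X
  ... | false | _     = CrossingEdge-map (ι b) (adj-ι b) (conn b (X ∘ ι b) u∈X τb∈X)
  ... | true  | true  = CrossingEdge-map (ι b′) (adj-ι b′) (conn b′ (X ∘ ι b′) τb′∈X w∉X)
  ... | true  | false =
    τ b , τ b′ , τb∈X , τb′∈X , adj-τ-τ {b} {b′} (λ b≡b′ → separated X τb∈X τb′∈X (cong τ b≡b′))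

  module _ (X : VSet (size D)) where

    Extends : ∀ i → List (Pivot (size (Gᵇ i))) → Set
    Extends i L = ∃[ L′ ] (Triangular D X L′ × length L < length L′)

    extend-front : ∀ i {L} → Triangular (Gᵇ i) (X ∘ ι i) L →
                   ∀ {r c} → X r ≡ true → X c ≡ false → adj D r c ≡ true →
                   (∀ {y} → X (ι i y) ≡ false → adj D r (ι i y) ≡ false) → Extends i L
    extend-front i {L} tri r∈X c∉X rc∈E clear =
      _ , pivot r∈X c∉X rc∈E (Allₚ.map⁺ (All.map clear (Triangular-columns tri)))
                             (Triangular-map (ι i) (adj-ι i) tri) ,
      s≤s (≤-reflexive (sym (length-map _ L)))

    extend-back : ∀ i {L} → Triangular (Gᵇ i) (X ∘ ι i) L →
                  ∀ {r c} → X r ≡ true → X c ≡ false → adj D r c ≡ true →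
                  (∀ {y} → X (ι i y) ≡ true → adj D (ι i y) c ≡ false) → Extends i L
    extend-back i {L} tri {r} {c} r∈X c∉X rc∈E clear =
      _ , Triangular-snoc (Triangular-map (ι i) (adj-ι i) tri)
                          (Allₚ.map⁺ (All.map clear (Triangular-rows tri))) r∈X c∉X rc∈E ,
      ≤-reflexive (trans (cong suc (sym (length-map _ L)))
                         (length-++-comm ((r , c) ∷ []) (map (Prod.map (ι i) (ι i)) L)))

    -- The new pivot is adjacent to block i at most through τ i, which then lies on the wrong
    -- side of X to be a column (front) or a row (back) of the pivots of block i.
    extend : ∀ {i j l} → i ≢ j → i ≢ l → j ≢ l → Connected (Gᵇ j) → Connected (Gᵇ l) →
             ∀ {L} → Triangular (Gᵇ i) (X ∘ ι i) L →
             ∀ {a c} → X (ι j a) ≡ true → X (ι l c) ≡ false → Extends i L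
    extend {i} {j} {l} i≢j i≢l j≢l conn-j conn-l tri a∈X c∉X with X (τ j) in τj∈X | X (τ l) in τl∈X
    ... | false | _ =
      let (a′ , b′ , a′∈X , b′∉X , a′b′∈E) = conn-j (X ∘ ι j) a∈X τj∈X in
      extend-front i tri a′∈X b′∉X (trans (adj-ι j a′ b′) a′b′∈E)
        (λ _ → adj-ι-ι-offˡ (≢-sym i≢j) (separated (X ∘ ι j) a′∈X τj∈X))
    ... | true | true =
      let (a′ , b′ , a′∈X , b′∉X , a′b′∈E) = conn-l (X ∘ ι l) τl∈X c∉X in
      extend-back i tri a′∈X b′∉X (trans (adj-ι l a′ b′) a′b′∈E)
        (λ _ → adj-ι-ι-offʳ i≢l (≢-sym (separated (X ∘ ι l) τl∈X b′∉X)))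
    ... | true | false with X (τ i) in τi∈X
    ...   | true  = extend-front i tri τj∈X τl∈X (adj-τ-τ j≢l)
                      (λ y∉X → adj-ι-ι-offʳ (≢-sym i≢j) (≢-sym (separated (X ∘ ι i) τi∈X y∉X)))
    ...   | false = extend-back i tri τj∈X τl∈X (adj-τ-τ j≢l)
                      (λ y∈X → adj-ι-ι-offˡ i≢l (separated (X ∘ ι i) y∈X τi∈X))

  EveryOrderHasPivots-D : ∀ {k} → (∀ b → EveryOrderHasPivots k (Gᵇ b)) →
                          (∀ b → Connected (Gᵇ b)) → EveryOrderHasPivots (suc k) D
  EveryOrderHasPivots-D {k} pivots conn pos pos-inj = from-middle (middle threshold)
    where
    restricted : ∀ b → ∃[ t ] ∃[ L ] (Triangular (Gᵇ b) (below (pos ∘ ι b) t) L × k < length L)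
    restricted b = pivots b (pos ∘ ι b) (λ e → ι-injective b (pos-inj e))

    threshold : Block → ℕ
    threshold = proj₁ ∘ restricted

    from-middle : ∃[ i ] ∃[ j ] ∃[ l ] (i ≢ j × i ≢ l × j ≢ l ×
                                        threshold j ≤ threshold i × threshold i ≤ threshold l) →
                  ∃[ t ] ∃[ L ] (Triangular D (below pos t) L × suc k < length L)
    from-middle (i , j , l , i≢j , i≢l , j≢l , tⱼ≤tᵢ , tᵢ≤tₗ)
      with restricted i | restricted j | restricted l
    ... | tᵢ , _ , tri , k<L | _ , _ , tri-j , k<Lⱼ | _ , _ , tri-l , k<Lₗ
      with Triangular-sides tri-j (≤-trans (s≤s z≤n) k<Lⱼ)
         | Triangular-sides tri-l (≤-trans (s≤s z≤n) k<Lₗ)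
    ... | _ , _ , a∈Xⱼ , _ | _ , _ , _ , c∉Xₗ =
      let a∈X = <ᵇ≡true (<-≤-trans (<ᵇ≡true⁻ _ _ a∈Xⱼ) tⱼ≤tᵢ)
          c∉X = <ᵇ≡false (≤-trans tᵢ≤tₗ (<ᵇ≡false⁻ _ _ c∉Xₗ))
          (L′ , tri′ , L<L′) = extend (below pos tᵢ) i≢j i≢l j≢l (conn j) (conn l) tri a∈X c∉X
      in tᵢ , L′ , tri′ , ≤-trans (s≤s k<L) L<L′

Δ⇒pivots×connected : ∀ k H → InΔ k H → EveryOrderHasPivots k H × Connected H
Δ⇒pivots×connected zero H H≅K₂ =
  EveryOrderHasPivots-≅ H≅K₂ EveryOrderHasPivots-K₂ , Connected-≅ H≅K₂ Connected-K₂
Δ⇒pivots×connected (suc k) H (G₁ , G₂ , G₃ , Δ₁ , Δ₂ , Δ₃ , v₁ , v₂ , v₃ , H≅D) =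
  EveryOrderHasPivots-≅ H≅D (EveryOrderHasPivots-D (proj₁ ∘ IH) (proj₂ ∘ IH)) ,
  Connected-≅ H≅D (Connected-D (proj₂ ∘ IH))
  where
  open DeltaComposition G₁ G₂ G₃ v₁ v₂ v₃
  IH : ∀ b → EveryOrderHasPivots k (Gᵇ b) × Connected (Gᵇ b)
  IH B₁ = Δ⇒pivots×connected k G₁ Δ₁
  IH B₂ = Δ⇒pivots×connected k G₂ Δ₂
  IH B₃ = Δ⇒pivots×connected k G₃ Δ₃

cutrk-prefix≤width : ∀ G (π : Layout G) {t} → t ≤ size G → cutrk G (prefix G π t) ≤ width G π
cutrk-prefix≤width G π t≤n = ≤-maxList (∈-map⁺ _ (∈-upTo⁺ (s≤s t≤n)))

lemma3p2 : (k : ℕ) (G : Graph) → InΔ k (raw G) →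
           ∀ r → IsLinearRankWidth (raw G) r → suc k ≤ r
lemma3p2 k G G∈Δₖ r ((π , width≡r) , _)
  with proj₁ (Δ⇒pivots×connected k (raw G) G∈Δₖ) (toℕ ∘ (π ⟨$⟩ˡ_))
             (λ e → ⟨$⟩ˡ-injective π (toℕ-injective e))
... | t , L , tri , k<L with Triangular-sides tri (≤-trans (s≤s z≤n) k<L)
... | _ , c , _ , c∉prefix = begin
  suc k                              ≤⟨ k<L ⟩
  length L                           ≤⟨ Triangular⇒≤cutrk tri ⟩
  cutrk (raw G) (prefix (raw G) π t) ≤⟨ cutrk-prefix≤width (raw G) π t≤n ⟩
  width (raw G) π                    ≡⟨ width≡r ⟩
  r                                  ∎
  where
  open ≤-Reasoning
  t≤n : t ≤ size (raw G)
  t≤n = ≤-trans (<ᵇ≡false⁻ _ _ c∉prefix) (<⇒≤ (toℕ<n (π ⟨$⟩ˡ c)))
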